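{- For all sentences $\Phi\in\mathsf{ICPDL}(\mathsf{AP},\Gamma)$ and all $k>0$, one can construct a sentence $\widetilde{\Phi}^k\in\mathsf{ICPDL}(\mathsf{AP}^k,\downarrow_0,\downarrow_1)$ of size $\mathcal{O}(k^2|\Phi|)$ such that for every valid $k$-STT $\tau$ with $[\![\tau]\!]=(G,\chi)$ we have $G\models\Phi$ iff $\tau\models\widetilde{\Phi}^k$. Moreover, if $\Phi\in\mathsf{LCPDL}(\mathsf{AP},\Gamma)$ then $\widetilde{\Phi}^k$ can be constructed in $\mathsf{LCPDL}(\mathsf{AP}^k,\downarrow_0,\downarrow_1)$.
   Context: ICPDL over atomic propositions $\mathsf{AP}$ and atomic programs $\Gamma$: sentences $\Phi::=\mathsf{E}\sigma\mid\Phi\vee\Phi\mid\neg\Phi$; state formulas $\sigma::=p\mid\sigma\vee\sigma\mid\neg\sigma\mid\langle\pi\rangle\sigma\mid\mathsf{Loop}\langle\pi\rangle$ ($p\in\mathsf{AP}$); path formulas $\pi::=\gamma\mid\mathsf{test}(\sigma)\mid\pi+\pi\mid\pi\cdot\pi\mid\pi^*\mid\pi^{ -1}\mid\pi\cap\pi$ ($\gamma\in\Gamma$). On $G=(V,(E_\gamma)_\gamma,\lambda)$ with $\lambda:V\to2^{\mathsf{AP}}$: $[\![p]\!]=\{v\mid p\in\lambda(v)\}$; $\vee,\neg$ as union/complement; $[\![\langle\pi\rangle\sigma]\!]=\{e\mid\exists f\in[\![\sigma]\!]:(e,f)\in[\![\pi]\!]\}$; $[\![\mathsf{Loop}\langle\pi\rangle]\!]=\{e\mid(e,e)\in[\![\pi]\!]\}$;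 $[\![\gamma]\!]=E_\gamma$; $[\![\mathsf{test}(\sigma)]\!]=\{(e,e)\mid e\in[\![\sigma]\!]\}$; $\pi^{ -1}$ inverse relation, $+$ union, $\cdot$ composition, $^*$ reflexive-transitive closure, $\cap$ intersection; $G\models\mathsf{E}\sigma$ iff $[\![\sigma]\!]\ne\emptyset$. LCPDL: the fragment without $\cap$. $k$-STTs over $(2^{\mathsf{AP}},\Gamma)$ with $[k]=\{1,..,k\}$: $\tau::=(i,a)\mid\mathsf{Add}^\gamma_{i,j}\tau\mid\mathsf{Forget}_i\tau\mid\tau\oplus\tau$ ($a\subseteq\mathsf{AP}$), denoting $[\![\tau]\!]=(G_\tau,\chi_\tau)$: single vertex labeled $a$ colored $i$; add $\gamma$-edge from vertex colored $i$ to vertex colored $j$ if both exist; remove color $i$; disjoint union defined only for disjoint color domains. Valid: all $\oplus$ defined. A $k$-STT is regarded as a tree, i.e., a graph whose vertices are the term's nodes with edge relations $\downarrow_0$ (first child) and $\downarrow_1$ (second child), labeled over $\mathsf{AP}^k=\mathsf{AP}\cup\{\oplus,\mathsf{color}_i,\mathsf{Add}^\gamma_{i,j},\mathsf{Forget}_i\mid i,j\in[k],\gamma\in\Gamma\}$: a leaf $(i,a)$ carries $a\cup\{\mathsf{color}_i\}$, inner nodes carry their operation symbol. The leaves are identified with the vertices of $G_\tau$. -}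

module Defs where

open import Data.Nat using (ℕ; suc; _+_)
open import Data.Fin using (Fin; _≟_)
open import Data.Bool using (Bool; T)
open import Data.Maybe using (Maybe; just; nothing)
import Data.Maybe as Maybe
open import Data.Product using (Σ; ∃; ∃-syntax; _×_; _,_)
open import Data.Sum using (_⊎_)
open import Data.Empty using (⊥)
open import Data.Unit using (⊤)
open import Relation.Nullary using (¬_; yes; no)
open import Relation.Binary.PropositionalEquality using (_≡_)
open import Relation.Binary.Construct.Closure.ReflexiveTransitive using (Star)

mutual
  data State (AP Γ : Set) : Set where
    atom  : AP → State AP Γ
    _∨ₛ_  : State AP Γ → State AP Γ → State AP Γ
    ¬ₛ_   : State AP Γ → State AP Γ
    ⟨_⟩_  : Path AP Γ → State AP Γ → State AP Γ
    Loop  : Path AP Γ → State AP Γ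

  data Path (AP Γ : Set) : Set where
    prog  : Γ → Path AP Γ
    test  : State AP Γ → Path AP Γ
    _+ₚ_  : Path AP Γ → Path AP Γ → Path AP Γ
    _·ₚ_  : Path AP Γ → Path AP Γ → Path AP Γ
    _*ₚ   : Path AP Γ → Path AP Γ
    _⁻¹ₚ  : Path AP Γ → Path AP Γ
    _∩ₚ_  : Path AP Γ → Path AP Γ → Path AP Γ

data Sentence (AP Γ : Set) : Set where
  E     : State AP Γ → Sentence AP Γ
  _∨ₑ_  : Sentence AP Γ → Sentence AP Γ → Sentence AP Γ
  ¬ₑ_   : Sentence AP Γ → Sentence AP Γ

mutual
  sizeS : ∀ {AP Γ} → State AP Γ → ℕ
  sizeS (atom p)   = 1
  sizeS (σ ∨ₛ σ')  = suc (sizeS σ + sizeS σ')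
  sizeS (¬ₛ σ)     = suc (sizeS σ)
  sizeS (⟨ π ⟩ σ)  = suc (sizeP π + sizeS σ)
  sizeS (Loop π)   = suc (sizeP π)

  sizeP : ∀ {AP Γ} → Path AP Γ → ℕ
  sizeP (prog γ)   = 1
  sizeP (test σ)   = suc (sizeS σ)
  sizeP (π +ₚ π')  = suc (sizeP π + sizeP π')
  sizeP (π ·ₚ π')  = suc (sizeP π + sizeP π')
  sizeP (π *ₚ)     = suc (sizeP π)
  sizeP (π ⁻¹ₚ)    = suc (sizeP π)
  sizeP (π ∩ₚ π')  = suc (sizeP π + sizeP π')

size : ∀ {AP Γ} → Sentence AP Γ → ℕ
size (E σ)      = suc (sizeS σ)
size (Φ ∨ₑ Ψ)   = suc (size Φ + size Ψ)
size (¬ₑ Φ)     = suc (size Φ)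

mutual
  LCPDLₛ : ∀ {AP Γ} → State AP Γ → Set
  LCPDLₛ (atom p)   = ⊤
  LCPDLₛ (σ ∨ₛ σ')  = LCPDLₛ σ × LCPDLₛ σ'
  LCPDLₛ (¬ₛ σ)     = LCPDLₛ σ
  LCPDLₛ (⟨ π ⟩ σ)  = LCPDLₚ π × LCPDLₛ σ
  LCPDLₛ (Loop π)   = LCPDLₚ π

  LCPDLₚ : ∀ {AP Γ} → Path AP Γ → Set
  LCPDLₚ (prog γ)   = ⊤
  LCPDLₚ (test σ)   = LCPDLₛ σ
  LCPDLₚ (π +ₚ π')  = LCPDLₚ π × LCPDLₚ π'
  LCPDLₚ (π ·ₚ π')  = LCPDLₚ π × LCPDLₚ π'
  LCPDLₚ (π *ₚ)     = LCPDLₚ π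
  LCPDLₚ (π ⁻¹ₚ)    = LCPDLₚ π
  LCPDLₚ (π ∩ₚ π')  = ⊥

IsLCPDL : ∀ {AP Γ} → Sentence AP Γ → Set
IsLCPDL (E σ)     = LCPDLₛ σ
IsLCPDL (Φ ∨ₑ Ψ)  = IsLCPDL Φ × IsLCPDL Ψ
IsLCPDL (¬ₑ Φ)    = IsLCPDL Φ

record Graph (AP Γ : Set) : Set₁ where
  field
    V   : Set
    Ed  : Γ → V → V → Set
    lab : V → AP → Set

module Sem {AP Γ : Set} (G : Graph AP Γ) where
  open Graph G

  mutual
    ⟦_⟧ˢ : State AP Γ → V → Set
    ⟦ atom p ⟧ˢ v    = lab v p
    ⟦ σ ∨ₛ σ' ⟧ˢ v   = ⟦ σ ⟧ˢ v ⊎ ⟦ σ' ⟧ˢ v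
    ⟦ ¬ₛ σ ⟧ˢ v      = ¬ ⟦ σ ⟧ˢ v
    ⟦ ⟨ π ⟩ σ ⟧ˢ e   = ∃[ f ] (⟦ π ⟧ᵖ e f × ⟦ σ ⟧ˢ f)
    ⟦ Loop π ⟧ˢ e    = ⟦ π ⟧ᵖ e e

    ⟦_⟧ᵖ : Path AP Γ → V → V → Set
    ⟦ prog γ ⟧ᵖ e f   = Ed γ e f
    ⟦ test σ ⟧ᵖ e f   = e ≡ f × ⟦ σ ⟧ˢ e
    ⟦ π +ₚ π' ⟧ᵖ e f  = ⟦ π ⟧ᵖ e f ⊎ ⟦ π' ⟧ᵖ e f
    ⟦ π ·ₚ π' ⟧ᵖ e f  = ∃[ g ] (⟦ π ⟧ᵖ e g × ⟦ π' ⟧ᵖ g f)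
    ⟦ π *ₚ ⟧ᵖ e f     = Star ⟦ π ⟧ᵖ e f
    ⟦ π ⁻¹ₚ ⟧ᵖ e f    = ⟦ π ⟧ᵖ f e
    ⟦ π ∩ₚ π' ⟧ᵖ e f  = ⟦ π ⟧ᵖ e f × ⟦ π' ⟧ᵖ e f

  ⊨ : Sentence AP Γ → Set
  ⊨ (E σ)     = ∃[ v ] ⟦ σ ⟧ˢ v
  ⊨ (Φ ∨ₑ Ψ)  = ⊨ Φ ⊎ ⊨ Ψ
  ⊨ (¬ₑ Φ)    = ¬ ⊨ Φ

_⊨_ : ∀ {AP Γ} → Graph AP Γ → Sentence AP Γ → Set
G ⊨ Φ = Sem.⊨ G Φ

-- k-STTs over (2^AP, Γ); a subset a ⊆ AP is given by its characteristic
-- function AP → Bool.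

data STT (AP Γ : Set) (k : ℕ) : Set where
  leaf   : Fin k → (AP → Bool) → STT AP Γ k
  Add    : Γ → Fin k → Fin k → STT AP Γ k → STT AP Γ k
  Forget : Fin k → STT AP Γ k → STT AP Γ k
  _⊕_    : STT AP Γ k → STT AP Γ k → STT AP Γ k

module _ {AP Γ : Set} {k : ℕ} where

  data Leaf : STT AP Γ k → Set where
    here     : ∀ {i a} → Leaf (leaf i a)
    inAdd    : ∀ {γ i j τ} → Leaf τ → Leaf (Add γ i j τ)
    inForget : ∀ {i τ} → Leaf τ → Leaf (Forget i τ)
    inL      : ∀ {τ₁ τ₂} → Leaf τ₁ → Leaf (τ₁ ⊕ τ₂)
    inR      : ∀ {τ₁ τ₂} → Leaf τ₂ → Leaf (τ₁ ⊕ τ₂)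

  χ : (τ : STT AP Γ k) → Fin k → Maybe (Leaf τ)
  χ (leaf i a) j with i ≟ j
  ... | yes _ = just here
  ... | no  _ = nothing
  χ (Add γ i j τ) l = Maybe.map inAdd (χ τ l)
  χ (Forget i τ) j with i ≟ j
  ... | yes _ = nothing
  ... | no  _ = Maybe.map inForget (χ τ j)
  χ (τ₁ ⊕ τ₂) j with χ τ₁ j
  ... | just u  = just (inL u)
  ... | nothing = Maybe.map inR (χ τ₂ j)

  Valid : STT AP Γ k → Set
  Valid (leaf i a)     = ⊤
  Valid (Add γ i j τ)  = Valid τ
  Valid (Forget i τ)   = Valid τ
  Valid (τ₁ ⊕ τ₂)      = Valid τ₁ × Valid τ₂ ×
                         ((j : Fin k) → χ τ₁ j ≡ nothing ⊎ χ τ₂ j ≡ nothing)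

  data Edge : (τ : STT AP Γ k) → Γ → Leaf τ → Leaf τ → Set where
    new   : ∀ {γ i j τ u v} → χ τ i ≡ just u → χ τ j ≡ just v →
            Edge (Add γ i j τ) γ (inAdd u) (inAdd v)
    old   : ∀ {γ' γ i j τ u v} → Edge τ γ' u v →
            Edge (Add γ i j τ) γ' (inAdd u) (inAdd v)
    fgt   : ∀ {γ i τ u v} → Edge τ γ u v →
            Edge (Forget i τ) γ (inForget u) (inForget v)
    left  : ∀ {γ τ₁ τ₂ u v} → Edge τ₁ γ u v → Edge (τ₁ ⊕ τ₂) γ (inL u) (inL v)
    right : ∀ {γ τ₁ τ₂ u v} → Edge τ₂ γ u v → Edge (τ₁ ⊕ τ₂) γ (inR u) (inR v)

  leafLabel : {τ : STT AP Γ k} → Leaf τ → AP → Bool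
  leafLabel (here {a = a}) = a
  leafLabel (inAdd u)      = leafLabel u
  leafLabel (inForget u)   = leafLabel u
  leafLabel (inL u)        = leafLabel u
  leafLabel (inR u)        = leafLabel u

  graphOf : STT AP Γ k → Graph AP Γ
  graphOf τ = record
    { V   = Leaf τ
    ; Ed  = Edge τ
    ; lab = λ v p → T (leafLabel v p)
    }

data APk (AP Γ : Set) (k : ℕ) : Set where
  ap     : AP → APk AP Γ k
  ⊕lab   : APk AP Γ k
  color  : Fin k → APk AP Γ k
  addL   : Γ → Fin k → Fin k → APk AP Γ k
  forget : Fin k → APk AP Γ k

data Dir : Set where
  ↓₀ ↓₁ : Dir

module _ {AP Γ : Set} {k : ℕ} where

  data Node : STT AP Γ k → Set where
    root     : ∀ {τ} → Node τ
    nAdd     : ∀ {γ i j τ} → Node τ → Node (Add γ i j τ)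
    nForget  : ∀ {i τ} → Node τ → Node (Forget i τ)
    nL       : ∀ {τ₁ τ₂} → Node τ₁ → Node (τ₁ ⊕ τ₂)
    nR       : ∀ {τ₁ τ₂} → Node τ₂ → Node (τ₁ ⊕ τ₂)

  sub : (τ : STT AP Γ k) → Node τ → STT AP Γ k
  sub τ root                   = τ
  sub (Add γ i j τ) (nAdd u)   = sub τ u
  sub (Forget i τ) (nForget u) = sub τ u
  sub (τ₁ ⊕ τ₂) (nL u)         = sub τ₁ u
  sub (τ₁ ⊕ τ₂) (nR u)         = sub τ₂ u

  data Child : Dir → (τ : STT AP Γ k) → Node τ → Node τ → Set where
    cAdd    : ∀ {γ i j τ} → Child ↓₀ (Add γ i j τ) root (nAdd root)
    cForget : ∀ {i τ} → Child ↓₀ (Forget i τ) root (nForget root)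
    c⊕₀     : ∀ {τ₁ τ₂} → Child ↓₀ (τ₁ ⊕ τ₂) root (nL root)
    c⊕₁     : ∀ {τ₁ τ₂} → Child ↓₁ (τ₁ ⊕ τ₂) root (nR root)
    uAdd    : ∀ {d γ i j τ u v} → Child d τ u v →
              Child d (Add γ i j τ) (nAdd u) (nAdd v)
    uForget : ∀ {d i τ u v} → Child d τ u v →
              Child d (Forget i τ) (nForget u) (nForget v)
    uL      : ∀ {d τ₁ τ₂ u v} → Child d τ₁ u v → Child d (τ₁ ⊕ τ₂) (nL u) (nL v)
    uR      : ∀ {d τ₁ τ₂ u v} → Child d τ₂ u v → Child d (τ₁ ⊕ τ₂) (nR u) (nR v)

  topLab : STT AP Γ k → APk AP Γ k → Set
  topLab (leaf i a) (ap p)              = T (a p)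
  topLab (leaf i a) (color j)           = i ≡ j
  topLab (Add γ i j τ) (addL γ' i' j')  = γ ≡ γ' × i ≡ i' × j ≡ j'
  topLab (Forget i τ) (forget j)        = i ≡ j
  topLab (τ₁ ⊕ τ₂) ⊕lab                 = ⊤
  topLab _ _                            = ⊥

  treeOf : STT AP Γ k → Graph (APk AP Γ k) Dir
  treeOf τ = record
    { V   = Node τ
    ; Ed  = λ d → Child d τ
    ; lab = λ u p → topLab (sub τ u) p
    }

module Submission where

-- A vertex of G_τ is a leaf of τ, so a state formula σ is translated into a
-- formula that holds exactly at the leaves whose vertex satisfies σ, and a
-- path formula π into one relating exactly the pairs of leaves related by π.
-- Negation and Kleene star are relativised to leaves; every other connective
-- is translated homomorphically.  The only real work is the atomic program γ:
-- there is a γ-edge u → v iff some node Add^γ_{i,j} has a child at which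
-- colour i is carried by u and colour j by v, and "colour i is carried by
-- leaf u at node y" is definable: u is coloured i and the climb from u to y
-- never passes a Forget_i node (on a valid term no ⊕ can shadow the colour).
-- A k-fold disjunction over the pairs (i , j) gives the O(k²) factor.

open import Defs
open import Data.Nat using (ℕ; zero; suc; _+_; _*_; _≤_; _<_; z≤n; s≤s)
open import Data.Nat.Properties
  using (≤-trans; ≤-refl; ≤-reflexive; +-assoc; m≤m+n; +-mono-≤; +-monoʳ-≤; *-monoʳ-≤;
         *-suc; *-distribˡ-+; *-identityʳ; m≤m*n; module ≤-Reasoning)
open import Data.Nat.Tactic.RingSolver using (solve-∀)
open import Data.Fin using (Fin; _≟_) renaming (zero to fzero; suc to fsuc)
open import Data.Maybe using (Maybe; just; nothing)
import Data.Maybe as Maybe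
open import Data.Maybe.Properties using (just-injective; map-just; map-nothing)
open import Data.Product using (Σ; _×_; _,_; ∃₂; ∃-syntax)
open import Data.Sum using (_⊎_; inj₁; inj₂)
open import Data.Empty using (⊥; ⊥-elim)
open import Data.Unit using (tt)
open import Relation.Nullary using (¬_; yes; no)
open import Relation.Binary.PropositionalEquality
  using (_≡_; refl; sym; trans; cong; subst)
open import Relation.Binary.Construct.Closure.ReflexiveTransitive
  using (Star; ε; _◅_; _◅◅_; gmap)
open import Function.Base using (case_of_)
open import Function.Bundles using (_⇔_; mk⇔)

map-just⁻¹ : ∀ {A B : Set} {f : A → B} (m : Maybe A) {b : B} →
             Maybe.map f m ≡ just b → ∃[ a ] (m ≡ just a × f a ≡ b)
map-just⁻¹ (just a) refl = a , refl , refl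

map-lift : ∀ {A B : Set} {f : A → B} {m m' : Maybe A} {b : B} →
           (∀ {a} → m ≡ just a → m' ≡ just a) → Maybe.map f m ≡ just b → Maybe.map f m' ≡ just b
map-lift {m = m} m⊑m' eq with map-just⁻¹ m eq
... | a , m≡a , refl = map-just (m⊑m' m≡a)

module _ {A B : Set} {f : A → B} (f-injective : ∀ {a b} → f a ≡ f b → a ≡ b)
         {R : A → A → Set} {S : B → B → Set}
         (reflect : ∀ {x y} → S x y → ∃₂ λ a b → f a ≡ x × f b ≡ y × R a b) where

  star-reflect : ∀ {u y} → Star S (f u) y → ∃[ v ] (f v ≡ y × Star R u v)
  star-reflect ε = _ , refl , ε
  star-reflect (s ◅ ss) with reflect s
  ... | a , b , fa≡fu , refl , r with star-reflect ss
  ...   | v , fv≡y , rs = v , fv≡y , subst (λ a → R a b) (f-injective fa≡fu) r ◅ rs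

module _ {L : Set} where

  always never : State L Dir
  always = Loop (prog ↓₀ *ₚ)
  never  = ¬ₛ always

  isLeaf : State L Dir
  isLeaf = ¬ₛ (⟨ prog ↓₀ ⟩ always)

  up : Path L Dir
  up = (prog ↓₀ ⁻¹ₚ) +ₚ (prog ↓₁ ⁻¹ₚ)

  disjunction : (n : ℕ) → (Fin n → Path L Dir) → Path L Dir
  disjunction zero    f = test never
  disjunction (suc n) f = f fzero +ₚ disjunction n (λ i → f (fsuc i))

module _ {AP Γ : Set} {k : ℕ} where
  private
    S = State (APk AP Γ k) Dir
    P = Path (APk AP Γ k) Dir

  climb : Fin k → P
  climb i = up ·ₚ test (¬ₛ atom (forget i))

  fromColour : Fin k → P
  fromColour i = test (atom (color i)) ·ₚ (climb i *ₚ)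

  addEdge : Γ → Fin k → Fin k → P
  addEdge γ i j =
    fromColour i ·ₚ ((prog ↓₀ ⁻¹ₚ) ·ₚ (test (atom (addL γ i j)) ·ₚ
      (prog ↓₀ ·ₚ (fromColour j ⁻¹ₚ))))

  progTr : Γ → P
  progTr γ = disjunction k (λ i → disjunction k (λ j → addEdge γ i j))

  mutual
    trS : State AP Γ → S
    trS (atom p)  = atom (ap p)
    trS (σ ∨ₛ σ') = trS σ ∨ₛ trS σ'
    trS (¬ₛ σ)    = ¬ₛ ((¬ₛ isLeaf) ∨ₛ trS σ)
    trS (⟨ π ⟩ σ) = ⟨ trP π ⟩ trS σ
    trS (Loop π)  = Loop (trP π)

    trP : Path AP Γ → P
    trP (prog γ)  = progTr γ
    trP (test σ)  = test (trS σ)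
    trP (π +ₚ π') = trP π +ₚ trP π'
    trP (π ·ₚ π') = trP π ·ₚ trP π'
    trP (π *ₚ)    = test isLeaf ·ₚ (trP π *ₚ)
    trP (π ⁻¹ₚ)   = trP π ⁻¹ₚ
    trP (π ∩ₚ π') = trP π ∩ₚ trP π'

  translate : Sentence AP Γ → Sentence (APk AP Γ k) Dir
  translate (E σ)    = E (trS σ)
  translate (Φ ∨ₑ Ψ) = translate Φ ∨ₑ translate Ψ
  translate (¬ₑ Φ)   = ¬ₑ translate Φ

module _ {L : Set} (G : Graph L Dir) where
  open Sem G

  disjunction-elim : ∀ n (f : Fin n → Path L Dir) {x y} →
                     ⟦ disjunction n f ⟧ᵖ x y → ∃[ i ] ⟦ f i ⟧ᵖ x y
  disjunction-elim zero    f (_ , notAlways) = ⊥-elim (notAlways ε)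
  disjunction-elim (suc n) f (inj₁ h) = fzero , h
  disjunction-elim (suc n) f (inj₂ h) with disjunction-elim n (λ i → f (fsuc i)) h
  ... | i , h' = fsuc i , h'

  disjunction-intro : ∀ n (f : Fin n → Path L Dir) {x y} (i : Fin n) →
                      ⟦ f i ⟧ᵖ x y → ⟦ disjunction n f ⟧ᵖ x y
  disjunction-intro (suc n) f fzero    h = inj₁ h
  disjunction-intro (suc n) f (fsuc i) h = inj₂ (disjunction-intro n (λ i → f (fsuc i)) i h)

module _ {AP Γ : Set} {k : ℕ} where

  disjunction-LCPDL : ∀ n (f : Fin n → Path (APk AP Γ k) Dir) →
                      (∀ i → LCPDLₚ (f i)) → LCPDLₚ (disjunction n f)
  disjunction-LCPDL zero    f lc = tt
  disjunction-LCPDL (suc n) f lc =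
    lc fzero , disjunction-LCPDL n (λ i → f (fsuc i)) (λ i → lc (fsuc i))

  mutual
    trS-LCPDL : ∀ (σ : State AP Γ) → LCPDLₛ σ → LCPDLₛ (trS {k = k} σ)
    trS-LCPDL (atom p)  lc         = tt
    trS-LCPDL (σ ∨ₛ σ') (lc , lc') = trS-LCPDL σ lc , trS-LCPDL σ' lc'
    trS-LCPDL (¬ₛ σ)    lc         = _ , trS-LCPDL σ lc
    trS-LCPDL (⟨ π ⟩ σ) (lc , lc') = trP-LCPDL π lc , trS-LCPDL σ lc'
    trS-LCPDL (Loop π)  lc         = trP-LCPDL π lc

    trP-LCPDL : ∀ (π : Path AP Γ) → LCPDLₚ π → LCPDLₚ (trP {k = k} π)
    trP-LCPDL (prog γ)  _ =
      disjunction-LCPDL k _ (λ i → disjunction-LCPDL k _ (λ j → _))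
    trP-LCPDL (test σ)  lc         = trS-LCPDL σ lc
    trP-LCPDL (π +ₚ π') (lc , lc') = trP-LCPDL π lc , trP-LCPDL π' lc'
    trP-LCPDL (π ·ₚ π') (lc , lc') = trP-LCPDL π lc , trP-LCPDL π' lc'
    trP-LCPDL (π *ₚ)    lc         = _ , trP-LCPDL π lc
    trP-LCPDL (π ⁻¹ₚ)   lc         = trP-LCPDL π lc
    trP-LCPDL (π ∩ₚ π') ()

  translate-LCPDL : ∀ (Φ : Sentence AP Γ) → IsLCPDL Φ → IsLCPDL (translate {k = k} Φ)
  translate-LCPDL (E σ)    lc         = trS-LCPDL σ lc
  translate-LCPDL (Φ ∨ₑ Ψ) (lc , lc') = translate-LCPDL Φ lc , translate-LCPDL Ψ lc'
  translate-LCPDL (¬ₑ Φ)   lc         = translate-LCPDL Φ lc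

disjunction-size : ∀ {L} n (f : Fin n → Path L Dir) B →
                   (∀ i → sizeP (f i) ≤ B) → sizeP (disjunction n f) ≤ n * suc B + 5
disjunction-size zero    f B bound = ≤-refl
disjunction-size (suc n) f B bound =
  s≤s (≤-trans (+-mono-≤ (bound fzero)
                         (disjunction-size n (λ i → f (fsuc i)) B (λ i → bound (fsuc i))))
               (≤-reflexive (sym (+-assoc B (n * suc B) 5))))

-- An atomic program becomes k² disjuncts of size 36, i.e. costs O(k²).
progTr-size : ∀ {AP Γ} k → 0 < k → (γ : Γ) → sizeP (progTr {AP} {Γ} {k} γ) ≤ 48 * (k * k)
progTr-size {AP} {Γ} k@(suc _) _ γ = begin
    sizeP (progTr {AP} {Γ} {k} γ)          ≤⟨ disjunction-size k (λ i → disjunction k (edge i)) (k * 37 + 5)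
                                                (λ i → disjunction-size k (edge i) 36 (λ j → ≤-refl)) ⟩
    k * suc (k * 37 + 5) + 5               ≡⟨ expand k ⟩
    37 * (k * k) + 6 * k + 5               ≤⟨ +-mono-≤ (+-monoʳ-≤ (37 * (k * k))
                                                 (*-monoʳ-≤ 6 (m≤m*n k k))) (m≤m*n 5 (k * k)) ⟩
    37 * (k * k) + 6 * (k * k) + 5 * (k * k) ≡⟨ collect (k * k) ⟩
    48 * (k * k)                           ∎
  where
    open ≤-Reasoning
    edge : Fin k → Fin k → Path (APk AP Γ k) Dir
    edge = addEdge γ
    expand : ∀ k → k * suc (k * 37 + 5) + 5 ≡ 37 * (k * k) + 6 * k + 5
    expand = solve-∀
    collect : ∀ K → 37 * K + 6 * K + 5 * K ≡ 48 * K
    collect = solve-∀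

-- 9 ≤ 48 k² for k ≥ 1: the constant 48 k² dominates every connective's cost.
48k²-large : ∀ k → 0 < k → 9 ≤ 48 * (k * k)
48k²-large k@(suc _) _ = ≤-trans (m≤m+n 9 39) (m≤m*n 48 (k * k))

module SizeBound {AP Γ : Set} {k : ℕ} (M : ℕ) (9≤M : 9 ≤ M)
                 (progTr≤M : ∀ (γ : Γ) → sizeP (progTr {AP} {Γ} {k} γ) ≤ M) where

  private
    1≤M : 1 ≤ M
    1≤M = ≤-trans (s≤s z≤n) 9≤M

    unary : ∀ {c s a} → c ≤ M → s ≤ M * a → c + s ≤ M * suc a
    unary {c} {s} {a} c≤M s≤ =
      subst (c + s ≤_) (sym (*-suc M a)) (+-mono-≤ c≤M s≤)

    binary : ∀ {s t a b} → s ≤ M * a → t ≤ M * b → suc (s + t) ≤ M * suc (a + b)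
    binary {s} {t} {a} {b} s≤ t≤ =
      unary 1≤M
            (subst (s + t ≤_) (sym (*-distribˡ-+ M a b)) (+-mono-≤ s≤ t≤))

  mutual
    trS-size : ∀ (σ : State AP Γ) → sizeS (trS {k = k} σ) ≤ M * sizeS σ
    trS-size (atom p)  = unary 1≤M z≤n
    trS-size (σ ∨ₛ σ') = binary (trS-size σ) (trS-size σ')
    trS-size (¬ₛ σ)    = unary 9≤M (trS-size σ)
    trS-size (⟨ π ⟩ σ) = binary (trP-size π) (trS-size σ)
    trS-size (Loop π)  = unary 1≤M (trP-size π)

    trP-size : ∀ (π : Path AP Γ) → sizeP (trP {k = k} π) ≤ M * sizeP π
    trP-size (prog γ)  = subst (_ ≤_) (sym (*-identityʳ M)) (progTr≤M γ)
    trP-size (test σ)  = unary 1≤M (trS-size σ)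
    trP-size (π +ₚ π') = binary (trP-size π) (trP-size π')
    trP-size (π ·ₚ π') = binary (trP-size π) (trP-size π')
    trP-size (π *ₚ)    = unary 9≤M (trP-size π)
    trP-size (π ⁻¹ₚ)   = unary 1≤M (trP-size π)
    trP-size (π ∩ₚ π') = binary (trP-size π) (trP-size π')

  translate-size : ∀ (Φ : Sentence AP Γ) → size (translate {k = k} Φ) ≤ M * size Φ
  translate-size (E σ)    = unary 1≤M (trS-size σ)
  translate-size (Φ ∨ₑ Ψ) = binary (translate-size Φ) (translate-size Ψ)
  translate-size (¬ₑ Φ)   = unary 1≤M (translate-size Φ)

module _ {AP Γ : Set} {k : ℕ} where
  private
    Term = STT AP Γ k

  nodeOf : ∀ {τ : Term} → Leaf τ → Node τ
  nodeOf here         = root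
  nodeOf (inAdd u)    = nAdd (nodeOf u)
  nodeOf (inForget u) = nForget (nodeOf u)
  nodeOf (inL u)      = nL (nodeOf u)
  nodeOf (inR u)      = nR (nodeOf u)

  IsLeafNode : ∀ {τ : Term} → Node τ → Set
  IsLeafNode x = ∃[ u ] nodeOf u ≡ x

  leafColour : ∀ {τ : Term} → Leaf τ → Fin k
  leafColour (here {i = i}) = i
  leafColour (inAdd u)      = leafColour u
  leafColour (inForget u)   = leafColour u
  leafColour (inL u)        = leafColour u
  leafColour (inR u)        = leafColour u

  sub-nodeOf : ∀ {τ : Term} (u : Leaf τ) → sub τ (nodeOf u) ≡ leaf (leafColour u) (leafLabel u)
  sub-nodeOf here         = refl
  sub-nodeOf (inAdd u)    = sub-nodeOf u
  sub-nodeOf (inForget u) = sub-nodeOf u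
  sub-nodeOf (inL u)      = sub-nodeOf u
  sub-nodeOf (inR u)      = sub-nodeOf u

  leafAt : ∀ {τ : Term} → Node τ → Maybe (Leaf τ)
  leafAt {leaf _ _}     root = just here
  leafAt {Add _ _ _ _}  root = nothing
  leafAt {Forget _ _}   root = nothing
  leafAt {_ ⊕ _}        root = nothing
  leafAt (nAdd x)    = Maybe.map inAdd (leafAt x)
  leafAt (nForget x) = Maybe.map inForget (leafAt x)
  leafAt (nL x)      = Maybe.map inL (leafAt x)
  leafAt (nR x)      = Maybe.map inR (leafAt x)

  leafAt-nodeOf : ∀ {τ : Term} (u : Leaf τ) → leafAt (nodeOf u) ≡ just u
  leafAt-nodeOf here         = refl
  leafAt-nodeOf (inAdd u)    = map-just (leafAt-nodeOf u)
  leafAt-nodeOf (inForget u) = map-just (leafAt-nodeOf u)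
  leafAt-nodeOf (inL u)      = map-just (leafAt-nodeOf u)
  leafAt-nodeOf (inR u)      = map-just (leafAt-nodeOf u)

  nodeOf-injective : ∀ {τ : Term} {u v : Leaf τ} → nodeOf u ≡ nodeOf v → u ≡ v
  nodeOf-injective {u = u} {v} e =
    just-injective (trans (sym (leafAt-nodeOf u)) (trans (cong leafAt e) (leafAt-nodeOf v)))

  leaf-node : ∀ {τ : Term} (x : Node τ) {i a} → sub τ x ≡ leaf i a → IsLeafNode x
  leaf-node root refl = here , refl
  leaf-node (nAdd x) e with leaf-node x e
  ... | u , refl = inAdd u , refl
  leaf-node (nForget x) e with leaf-node x e
  ... | u , refl = inForget u , refl
  leaf-node (nL x) e with leaf-node x e
  ... | u , refl = inL u , refl
  leaf-node (nR x) e with leaf-node x e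
  ... | u , refl = inR u , refl

  ap-at-leaf : ∀ {τ : Term} (x : Node τ) {p} → topLab (sub τ x) (ap p) → IsLeafNode x
  ap-at-leaf {τ} x h with sub τ x in e
  ... | leaf _ _     = leaf-node x e
  ... | Add _ _ _ _  = ⊥-elim h
  ... | Forget _ _   = ⊥-elim h
  ... | _ ⊕ _        = ⊥-elim h

  colour-at-leaf : ∀ {τ : Term} (x : Node τ) {i} → topLab (sub τ x) (color i) → IsLeafNode x
  colour-at-leaf {τ} x h with sub τ x in e
  ... | leaf _ _     = leaf-node x e
  ... | Add _ _ _ _  = ⊥-elim h
  ... | Forget _ _   = ⊥-elim h
  ... | _ ⊕ _        = ⊥-elim h

  leaf-childless : ∀ {τ : Term} {d y} (u : Leaf τ) → ¬ Child d τ (nodeOf u) y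
  leaf-childless here ()
  leaf-childless (inAdd u)    (uAdd c)    = leaf-childless u c
  leaf-childless (inForget u) (uForget c) = leaf-childless u c
  leaf-childless (inL u)      (uL c)      = leaf-childless u c
  leaf-childless (inR u)      (uR c)      = leaf-childless u c

  leaf-or-parent : ∀ {τ : Term} (x : Node τ) → IsLeafNode x ⊎ ∃[ y ] Child ↓₀ τ x y
  leaf-or-parent {leaf i a}    root = inj₁ (here , refl)
  leaf-or-parent {Add γ i j τ} root = inj₂ (_ , cAdd)
  leaf-or-parent {Forget i τ}  root = inj₂ (_ , cForget)
  leaf-or-parent {τ₁ ⊕ τ₂}     root = inj₂ (_ , c⊕₀)
  leaf-or-parent (nAdd x) with leaf-or-parent x
  ... | inj₁ (u , refl) = inj₁ (inAdd u , refl)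
  ... | inj₂ (y , c)    = inj₂ (nAdd y , uAdd c)
  leaf-or-parent (nForget x) with leaf-or-parent x
  ... | inj₁ (u , refl) = inj₁ (inForget u , refl)
  ... | inj₂ (y , c)    = inj₂ (nForget y , uForget c)
  leaf-or-parent (nL x) with leaf-or-parent x
  ... | inj₁ (u , refl) = inj₁ (inL u , refl)
  ... | inj₂ (y , c)    = inj₂ (nL y , uL c)
  leaf-or-parent (nR x) with leaf-or-parent x
  ... | inj₁ (u , refl) = inj₁ (inR u , refl)
  ... | inj₂ (y , c)    = inj₂ (nR y , uR c)

  child-unique : ∀ {d} {τ : Term} {p y y'} → Child d τ p y → Child d τ p y' → y ≡ y'
  child-unique cAdd        cAdd         = refl
  child-unique cForget     cForget      = refl
  child-unique c⊕₀         c⊕₀          = refl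
  child-unique c⊕₁         c⊕₁          = refl
  child-unique (uAdd c)    (uAdd c')    = cong nAdd (child-unique c c')
  child-unique (uForget c) (uForget c') = cong nForget (child-unique c c')
  child-unique (uL c)      (uL c')      = cong nL (child-unique c c')
  child-unique (uR c)      (uR c')      = cong nR (child-unique c c')

  colourAt : (τ : Term) → Node τ → Fin k → Maybe (Leaf τ)
  colourAt τ             root        i = χ τ i
  colourAt (Add _ _ _ τ) (nAdd y)    i = Maybe.map inAdd (colourAt τ y i)
  colourAt (Forget _ τ)  (nForget y) i = Maybe.map inForget (colourAt τ y i)
  colourAt (τ₁ ⊕ _)      (nL y)      i = Maybe.map inL (colourAt τ₁ y i)
  colourAt (_ ⊕ τ₂)      (nR y)      i = Maybe.map inR (colourAt τ₂ y i)

  colourAt-leaf : ∀ {τ : Term} (u : Leaf τ) {i} →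
                  topLab (sub τ (nodeOf u)) (color i) → colourAt τ (nodeOf u) i ≡ just u
  colourAt-leaf (here {i = i'}) {i} h with i' ≟ i
  ... | yes _  = refl
  ... | no i≢i = ⊥-elim (i≢i h)
  colourAt-leaf (inAdd u)    h = map-just (colourAt-leaf u h)
  colourAt-leaf (inForget u) h = map-just (colourAt-leaf u h)
  colourAt-leaf (inL u)      h = map-just (colourAt-leaf u h)
  colourAt-leaf (inR u)      h = map-just (colourAt-leaf u h)

  Climb : (τ : Term) → Fin k → Node τ → Node τ → Set
  Climb τ i = Sem.⟦_⟧ᵖ (treeOf τ) (climb i)

  -- climbing past a node other than Forget_i keeps the holder of colour i;
  -- validity guarantees that a colour coming from the right of a ⊕ is not
  -- shadowed by the left
  parent-keeps-colour : ∀ {d} {τ : Term} {p x i u} → Valid τ → Child d τ p x →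
                        ¬ topLab (sub τ p) (forget i) →
                        colourAt τ x i ≡ just u → colourAt τ p i ≡ just u
  parent-keeps-colour _ cAdd _ eq = eq
  parent-keeps-colour {i = i} _ (cForget {i = j}) notForget eq with j ≟ i
  ... | yes j≡i = ⊥-elim (notForget j≡i)
  ... | no _    = eq
  parent-keeps-colour {i = i} _ (c⊕₀ {τ₁ = τ₁}) _ eq with χ τ₁ i
  ... | just _ = eq
  parent-keeps-colour {i = i} (_ , _ , disjoint) (c⊕₁ {τ₁ = τ₁} {τ₂}) _ eq
    with χ τ₁ i | disjoint i
  ... | nothing | _          = eq
  ... | just _  | inj₁ ()
  ... | just _  | inj₂ τ₂-free = case trans (sym (map-nothing τ₂-free)) eq of λ ()
  parent-keeps-colour valid           (uAdd c)    nf = map-lift (parent-keeps-colour valid c nf)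
  parent-keeps-colour valid           (uForget c) nf = map-lift (parent-keeps-colour valid c nf)
  parent-keeps-colour (valid , _)     (uL c)      nf = map-lift (parent-keeps-colour valid c nf)
  parent-keeps-colour (_ , valid , _) (uR c)      nf = map-lift (parent-keeps-colour valid c nf)

  climb-keeps-colour : ∀ {τ : Term} {i x y u} → Valid τ → Star (Climb τ i) x y →
                       colourAt τ x i ≡ just u → colourAt τ y i ≡ just u
  climb-keeps-colour valid ε eq = eq
  climb-keeps-colour valid ((p , inj₁ c , refl , nf) ◅ steps) eq =
    climb-keeps-colour valid steps (parent-keeps-colour valid c nf eq)
  climb-keeps-colour valid ((p , inj₂ c , refl , nf) ◅ steps) eq =
    climb-keeps-colour valid steps (parent-keeps-colour valid c nf eq)

  climb-lift : ∀ {τ τ' : Term} (f : Node τ → Node τ') →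
               (∀ {d a b} → Child d τ a b → Child d τ' (f a) (f b)) →
               (∀ a → sub τ' (f a) ≡ sub τ a) →
               ∀ {i x y} → Climb τ i x y → Climb τ' i (f x) (f y)
  climb-lift f child same {i} (p , c , refl , nf) =
    f p , Data.Sum.map child child c , refl ,
    subst (λ t → ¬ topLab t (forget i)) (sym (same p)) nf

  ColourSource : (τ : Term) → Node τ → Fin k → Leaf τ → Set
  ColourSource τ y i u = topLab (sub τ (nodeOf u)) (color i) × Star (Climb τ i) (nodeOf u) y

  root-colour-source : ∀ (τ : Term) {i u} → χ τ i ≡ just u → ColourSource τ root i u
  root-colour-source (leaf i' a) {i} eq with i' ≟ i
  root-colour-source (leaf i' a) {i} refl | yes i'≡i = i'≡i , ε
  root-colour-source (Add γ a b τ) {i} eq with map-just⁻¹ (χ τ i) eq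
  ... | w , e , refl with root-colour-source τ e
  ... | col , st = col , gmap nAdd (climb-lift nAdd uAdd (λ _ → refl)) st
                         ◅◅ (root , inj₁ cAdd , refl , λ ()) ◅ ε
  root-colour-source (Forget j τ) {i} eq with j ≟ i
  ... | no j≢i with map-just⁻¹ (χ τ i) eq
  ... | w , e , refl with root-colour-source τ e
  ... | col , st = col , gmap nForget (climb-lift nForget uForget (λ _ → refl)) st
                         ◅◅ (root , inj₁ cForget , refl , j≢i) ◅ ε
  root-colour-source (τ₁ ⊕ τ₂) {i} eq with χ τ₁ i in e
  root-colour-source (τ₁ ⊕ τ₂) {i} refl | just w with root-colour-source τ₁ e
  ... | col , st = col , gmap nL (climb-lift nL uL (λ _ → refl)) st
                         ◅◅ (root , inj₁ c⊕₀ , refl , λ ()) ◅ ε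
  root-colour-source (τ₁ ⊕ τ₂) {i} eq | nothing with map-just⁻¹ (χ τ₂ i) eq
  ... | w , e' , refl with root-colour-source τ₂ e'
  ... | col , st = col , gmap nR (climb-lift nR uR (λ _ → refl)) st
                         ◅◅ (root , inj₂ c⊕₁ , refl , λ ()) ◅ ε

  colour-source : ∀ (τ : Term) (y : Node τ) {i u} → colourAt τ y i ≡ just u → ColourSource τ y i u
  colour-source τ root eq = root-colour-source τ eq
  colour-source (Add _ _ _ τ) (nAdd y) {i} eq with map-just⁻¹ (colourAt τ y i) eq
  ... | w , e , refl with colour-source τ y e
  ... | col , st = col , gmap nAdd (climb-lift nAdd uAdd (λ _ → refl)) st
  colour-source (Forget _ τ) (nForget y) {i} eq with map-just⁻¹ (colourAt τ y i) eq
  ... | w , e , refl with colour-source τ y e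
  ... | col , st = col , gmap nForget (climb-lift nForget uForget (λ _ → refl)) st
  colour-source (τ₁ ⊕ _) (nL y) {i} eq with map-just⁻¹ (colourAt τ₁ y i) eq
  ... | w , e , refl with colour-source τ₁ y e
  ... | col , st = col , gmap nL (climb-lift nL uL (λ _ → refl)) st
  colour-source (_ ⊕ τ₂) (nR y) {i} eq with map-just⁻¹ (colourAt τ₂ y i) eq
  ... | w , e , refl with colour-source τ₂ y e
  ... | col , st = col , gmap nR (climb-lift nR uR (λ _ → refl)) st

  AddedAt : (τ : Term) → Γ → Leaf τ → Leaf τ → Set
  AddedAt τ γ u v = ∃₂ λ (i j : Fin k) → ∃₂ λ (p y : Node τ) →
    Child ↓₀ τ p y × topLab (sub τ p) (addL γ i j) ×
    colourAt τ y i ≡ just u × colourAt τ y j ≡ just v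

  added-lift : ∀ {τ τ' : Term} {γ u v} (f : Node τ → Node τ') (g : Leaf τ → Leaf τ') →
               (∀ {d a b} → Child d τ a b → Child d τ' (f a) (f b)) →
               (∀ a → sub τ' (f a) ≡ sub τ a) →
               (∀ y i → colourAt τ' (f y) i ≡ Maybe.map g (colourAt τ y i)) →
               AddedAt τ γ u v → AddedAt τ' γ (g u) (g v)
  added-lift {γ = γ} f g child same colour (i , j , p , y , c , t , eu , ev) =
    i , j , f p , f y , child c , subst (λ s → topLab s (addL γ i j)) (sym (same p)) t ,
    trans (colour y i) (map-just eu) , trans (colour y j) (map-just ev)

  edge-added : ∀ {τ : Term} {γ u v} → Edge τ γ u v → AddedAt τ γ u v
  edge-added (new {i = i} {j = j} eu ev) =
    i , j , root , nAdd root , cAdd , (refl , refl , refl) , map-just eu , map-just ev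
  edge-added (old e)   = added-lift nAdd    inAdd    uAdd    (λ _ → refl) (λ _ _ → refl) (edge-added e)
  edge-added (fgt e)   = added-lift nForget inForget uForget (λ _ → refl) (λ _ _ → refl) (edge-added e)
  edge-added (left e)  = added-lift nL      inL      uL      (λ _ → refl) (λ _ _ → refl) (edge-added e)
  edge-added (right e) = added-lift nR      inR      uR      (λ _ → refl) (λ _ _ → refl) (edge-added e)

  added-edge : ∀ {τ : Term} {γ i j p y u v} → Child ↓₀ τ p y → topLab (sub τ p) (addL γ i j) →
               colourAt τ y i ≡ just u → colourAt τ y j ≡ just v → Edge τ γ u v
  added-edge {Add γ i j τ} cAdd (refl , refl , refl) eu ev
    with map-just⁻¹ (χ τ i) eu | map-just⁻¹ (χ τ j) ev
  ... | _ , eu' , refl | _ , ev' , refl = new eu' ev'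
  added-edge {Add _ _ _ τ} {i = i} {j} {y = nAdd y} (uAdd c) t eu ev
    with map-just⁻¹ (colourAt τ y i) eu | map-just⁻¹ (colourAt τ y j) ev
  ... | _ , eu' , refl | _ , ev' , refl = old (added-edge c t eu' ev')
  added-edge {Forget _ τ} {i = i} {j} {y = nForget y} (uForget c) t eu ev
    with map-just⁻¹ (colourAt τ y i) eu | map-just⁻¹ (colourAt τ y j) ev
  ... | _ , eu' , refl | _ , ev' , refl = fgt (added-edge c t eu' ev')
  added-edge {τ₁ ⊕ _} {i = i} {j} {y = nL y} (uL c) t eu ev
    with map-just⁻¹ (colourAt τ₁ y i) eu | map-just⁻¹ (colourAt τ₁ y j) ev
  ... | _ , eu' , refl | _ , ev' , refl = left (added-edge c t eu' ev')
  added-edge {_ ⊕ τ₂} {i = i} {j} {y = nR y} (uR c) t eu ev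
    with map-just⁻¹ (colourAt τ₂ y i) eu | map-just⁻¹ (colourAt τ₂ y j) ev
  ... | _ , eu' , refl | _ , ev' , refl = right (added-edge c t eu' ev')

module Correctness {AP Γ : Set} {k : ℕ} (τ : STT AP Γ k) (valid : Valid τ) where
  private
    module G = Sem (graphOf τ)
    module T = Sem (treeOf τ)

  AtLeaf : (Leaf τ → Set) → Node τ → Set
  AtLeaf P x = ∃[ u ] (nodeOf u ≡ x × P u)

  BetweenLeaves : (Leaf τ → Leaf τ → Set) → Node τ → Node τ → Set
  BetweenLeaves R x y = ∃₂ λ u v → nodeOf u ≡ x × nodeOf v ≡ y × R u v

  at-leaf : ∀ {P u} → AtLeaf P (nodeOf u) → P u
  at-leaf {P} (_ , e , h) = subst P (nodeOf-injective e) h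

  from-leaf : ∀ {R u y} → BetweenLeaves R (nodeOf u) y → AtLeaf (R u) y
  from-leaf {R} (_ , v , e , e' , r) = v , e' , subst (λ a → R a v) (nodeOf-injective e) r

  isLeaf-complete : ∀ u → T.⟦ isLeaf ⟧ˢ (nodeOf u)
  isLeaf-complete u (_ , c , _) = leaf-childless u c

  isLeaf-sound : ∀ x → ¬ ¬ T.⟦ isLeaf ⟧ˢ x → IsLeafNode x
  isLeaf-sound x ¬¬leaf with leaf-or-parent x
  ... | inj₁ isLeafNode = isLeafNode
  ... | inj₂ (y , c)    = ⊥-elim (¬¬leaf (λ atLeaf → atLeaf (y , c , ε)))

  fromColour-complete : ∀ {i u} (y : Node τ) → colourAt τ y i ≡ just u →
                        T.⟦ fromColour i ⟧ᵖ (nodeOf u) y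
  fromColour-complete y eq with colour-source τ y eq
  ... | col , climbs = _ , (refl , col) , climbs

  fromColour-sound : ∀ {i x y} → T.⟦ fromColour i ⟧ᵖ x y → AtLeaf (λ u → colourAt τ y i ≡ just u) x
  fromColour-sound {x = x} (_ , (refl , col) , climbs) with colour-at-leaf x col
  ... | u , refl = u , refl , climb-keeps-colour valid climbs (colourAt-leaf u col)

  progTr-complete : ∀ {γ u v} → Edge τ γ u v → T.⟦ progTr γ ⟧ᵖ (nodeOf u) (nodeOf v)
  progTr-complete e with edge-added e
  ... | i , j , p , y , c , t , eu , ev =
    disjunction-intro (treeOf τ) k _ i (disjunction-intro (treeOf τ) k _ j
      (y , fromColour-complete y eu , p , c , p , (refl , t) , y , c , fromColour-complete y ev))

  progTr-sound : ∀ {γ x z} → T.⟦ progTr γ ⟧ᵖ x z → BetweenLeaves (Edge τ γ) x z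
  progTr-sound h with disjunction-elim (treeOf τ) k _ h
  ... | i , h' with disjunction-elim (treeOf τ) k _ h'
  ... | j , (y , from-u , p , c , _ , (refl , t) , y' , c' , from-v) with child-unique c c'
  ... | refl with fromColour-sound from-u | fromColour-sound from-v
  ... | u , refl , eu | v , refl , ev = u , v , refl , refl , added-edge c t eu ev

  mutual
    state-complete : ∀ σ {u} → G.⟦ σ ⟧ˢ u → T.⟦ trS σ ⟧ˢ (nodeOf u)
    state-complete (atom p)  {u} h  = subst (λ t → topLab t (ap p)) (sym (sub-nodeOf u)) h
    state-complete (σ ∨ₛ σ') (inj₁ h) = inj₁ (state-complete σ h)
    state-complete (σ ∨ₛ σ') (inj₂ h) = inj₂ (state-complete σ' h)
    state-complete (¬ₛ σ) {u} _ (inj₁ notLeaf) = notLeaf (isLeaf-complete u)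
    state-complete (¬ₛ σ)     h (inj₂ h')      = h (at-leaf (state-sound σ h'))
    state-complete (⟨ π ⟩ σ) (v , r , h) = nodeOf v , path-complete π r , state-complete σ h
    state-complete (Loop π)  r = path-complete π r

    state-sound : ∀ σ {x} → T.⟦ trS σ ⟧ˢ x → AtLeaf G.⟦ σ ⟧ˢ x
    state-sound (atom p) {x} h with ap-at-leaf x h
    ... | u , refl = u , refl , subst (λ t → topLab t (ap p)) (sub-nodeOf u) h
    state-sound (σ ∨ₛ σ') (inj₁ h) with state-sound σ h
    ... | u , e , h' = u , e , inj₁ h'
    state-sound (σ ∨ₛ σ') (inj₂ h) with state-sound σ' h
    ... | u , e , h' = u , e , inj₂ h'
    state-sound (¬ₛ σ) {x} h with isLeaf-sound x (λ atLeaf → h (inj₁ atLeaf))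
    ... | u , refl = u , refl , λ h' → h (inj₂ (state-complete σ h'))
    state-sound (⟨ π ⟩ σ) (_ , r , h) with path-sound π r
    ... | u , v , refl , refl , r' = u , refl , v , r' , at-leaf (state-sound σ h)
    state-sound (Loop π) r with path-sound π r
    ... | u , v , refl , e , r' = u , refl , subst (G.⟦ π ⟧ᵖ u) (nodeOf-injective e) r'

    path-complete : ∀ π {u v} → G.⟦ π ⟧ᵖ u v → T.⟦ trP π ⟧ᵖ (nodeOf u) (nodeOf v)
    path-complete (prog γ)  e          = progTr-complete e
    path-complete (test σ)  (refl , h) = refl , state-complete σ h
    path-complete (π +ₚ π') (inj₁ r)   = inj₁ (path-complete π r)
    path-complete (π +ₚ π') (inj₂ r)   = inj₂ (path-complete π' r)
    path-complete (π ·ₚ π') (w , r , r') = nodeOf w , path-complete π r , path-complete π' r'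
    path-complete (π *ₚ) {u} rs =
      nodeOf u , (refl , isLeaf-complete u) , gmap nodeOf (path-complete π) rs
    path-complete (π ⁻¹ₚ)   r          = path-complete π r
    path-complete (π ∩ₚ π') (r , r')   = path-complete π r , path-complete π' r'

    path-sound : ∀ π {x y} → T.⟦ trP π ⟧ᵖ x y → BetweenLeaves G.⟦ π ⟧ᵖ x y
    path-sound (prog γ) r = progTr-sound r
    path-sound (test σ) (refl , h) with state-sound σ h
    ... | u , refl , h' = u , u , refl , refl , (refl , h')
    path-sound (π +ₚ π') (inj₁ r) with path-sound π r
    ... | u , v , ex , ey , r' = u , v , ex , ey , inj₁ r'
    path-sound (π +ₚ π') (inj₂ r) with path-sound π' r
    ... | u , v , ex , ey , r' = u , v , ex , ey , inj₂ r'
    path-sound (π ·ₚ π') (_ , r , r') with path-sound π r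
    ... | u , w , refl , refl , s with from-leaf (path-sound π' r')
    ...   | v , refl , s' = u , v , refl , refl , w , s , s'
    path-sound (π *ₚ) {x} (_ , (refl , atLeaf) , rs) with isLeaf-sound x (λ notLeaf → notLeaf atLeaf)
    ... | u , refl with star-reflect nodeOf-injective (path-sound π) rs
    ...   | v , refl , ss = u , v , refl , refl , ss
    path-sound (π ⁻¹ₚ) r with path-sound π r
    ... | u , v , ex , ey , r' = v , u , ey , ex , r'
    path-sound (π ∩ₚ π') (r , r') with path-sound π r
    ... | u , v , refl , refl , s = u , v , refl , refl , s , at-leaf (from-leaf (path-sound π' r'))

  mutual
    sentence-complete : ∀ Φ → graphOf τ ⊨ Φ → treeOf τ ⊨ translate Φ
    sentence-complete (E σ)    (u , h)  = nodeOf u , state-complete σ h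
    sentence-complete (Φ ∨ₑ Ψ) (inj₁ h) = inj₁ (sentence-complete Φ h)
    sentence-complete (Φ ∨ₑ Ψ) (inj₂ h) = inj₂ (sentence-complete Ψ h)
    sentence-complete (¬ₑ Φ)   h h'     = h (sentence-sound Φ h')

    sentence-sound : ∀ Φ → treeOf τ ⊨ translate Φ → graphOf τ ⊨ Φ
    sentence-sound (E σ) (_ , h) with state-sound σ h
    ... | u , _ , h' = u , h'
    sentence-sound (Φ ∨ₑ Ψ) (inj₁ h) = inj₁ (sentence-sound Φ h)
    sentence-sound (Φ ∨ₑ Ψ) (inj₂ h) = inj₂ (sentence-sound Ψ h)
    sentence-sound (¬ₑ Φ)   h h'     = h (sentence-complete Φ h')

  sentence-correct : ∀ Φ → (graphOf τ ⊨ Φ) ⇔ (treeOf τ ⊨ translate Φ)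
  sentence-correct Φ = mk⇔ (sentence-complete Φ) (sentence-sound Φ)

mainTheorem11 : Σ ℕ λ C → (AP Γ : Set) →
    Σ ((k : ℕ) → Sentence AP Γ → Sentence (APk AP Γ k) Dir) λ tr →
      (k : ℕ) → 0 < k → (Φ : Sentence AP Γ) →
        (size (tr k Φ) ≤ C * (k * k) * size Φ)
        × ((τ : STT AP Γ k) → Valid τ → ((graphOf τ ⊨ Φ) ⇔ (treeOf τ ⊨ tr k Φ)))
        × (IsLCPDL Φ → IsLCPDL (tr k Φ))
mainTheorem11 = 48 , λ AP Γ → (λ k → translate {AP} {Γ} {k}) , λ k 0<k Φ →
  SizeBound.translate-size (48 * (k * k)) (48k²-large k 0<k) (progTr-size k 0<k) Φ ,
  (λ τ valid → Correctness.sentence-correct τ valid Φ) ,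
  translate-LCPDL Φ
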